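{- Let $P$ be a weakly ranked, finite, bounded poset of weak rank $n$, and let $h(P)=(h_0,h_1,\ldots,h_{n-1})$ be the sequence of coefficients of its Chow polynomial $H_P(t)=\sum_{i=0}^{n-1}h_it^i$. Then $h(P)$ is an $\operatorname{SI}$-sequence.
   Context: A weak rank function on a poset $P$ is a function $\rho:P\times P\to\mathbb{N}$, $(x,y)\mapsto\rho_{x,y}$, such that $\rho_{x,y}>0$ if and only if $x<y$, and $\rho_{x,y}=\rho_{x,z}+\rho_{z,y}$ for all $x\le z\le y$. A weakly ranked poset is a poset with a chosen weak rank function. $P$ is bounded if it has a least element $\hat 0$ and a greatest element $\hat 1$; write $\rho(x)=\rho_{\hat0,x}$, and the weak rank of $P$ is $\rho(P)=\rho(\hat1)$. The Chow polynomial of $P$ is $$H_P(t)=\sum_{s\ge 0}\ \sum_{\hat0=p_0<p_1<\cdots<p_s\le \hat1}\ \prod_{i=1}^{s}\frac{t\left(t^{\rho(p_i)-\rho(p_{i-1})-1}-1\right)}{t-1},$$ where the inner sum is over all chains starting at $\hat0$ (the empty product for $s=0$ equals $1$); it has degree $n-1$, nonnegative palindromic unimodal coefficients, and $h_0=1$. A monomial order ideal is a finite set of monomials (in finitely many variables) closed under taking divisors; its $h$-vector $(h_0,\ldots,h_e)$ records the number $h_d$ of its monomials of degree $d$. A sequence of nonnegative integers is an $O$-sequence if it is the $h$-vector of a monomial order ideal. For a palindromic unimodal sequence $h=(1,h_1,\ldots,h_e)$ its differential sequence is $\Delta h=(1,h_1-1,h_2-h_1,\ldots,h_{\lfloor e/2\rfloor}-h_{\lfloor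 e/2\rfloor-1})$. An $\operatorname{SI}$-sequence is a nonnegative palindromic sequence $h$ (with $h_0=1$) such that $\Delta h$ is an $O$-sequence. -}

module Defs where

open import Data.Nat using (ℕ; zero; suc; _+_; _*_; _∸_; _≤_; _<_; _≟_; ⌊_/2⌋)
open import Data.Integer as ℤ using (ℤ; +_)
open import Data.Fin using (Fin)
open import Data.Fin.Properties using () renaming (_≟_ to _≟ᶠ_)
open import Data.List using (List; []; _∷_; map; replicate; concatMap; foldr; upTo; filter; length; reverse; allFin)
open import Data.Vec as Vec using (Vec)
open import Data.List.Membership.Propositional using (_∈_)
open import Data.List.Relation.Unary.Unique.Propositional using (Unique)
open import Data.Product using (Σ; _×_; ∃)
open import Data.Bool using (if_then_else_)
open import Relation.Nullary using (¬_; Dec; does)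
open import Relation.Nullary.Decidable using (_×-dec_; ¬?)
open import Relation.Binary.Core using (Rel)
open import Relation.Binary.Definitions using (Decidable)
open import Relation.Binary.Structures using (IsPartialOrder)
open import Relation.Binary.PropositionalEquality using (_≡_)

-- A finite poset is represented on the carrier Fin m with a decidable
-- partial order (decidability of the order is automatic classically for
-- finite posets; it is needed to enumerate chains constructively).

record WeaklyRankedBoundedPoset (m : ℕ) : Set₁ where
  field
    _≼_        : Rel (Fin m) _
    isPartialOrder : IsPartialOrder _≡_ _≼_
    _≼?_       : Decidable _≼_
    bot        : Fin m
    top        : Fin m
    bot-least  : ∀ x → bot ≼ x
    top-greatest : ∀ x → x ≼ top
    ρ₂         : Fin m → Fin m → ℕ
    ρ-pos      : ∀ x y → (0 < ρ₂ x y → (x ≼ y × ¬ x ≡ y))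
                       × ((x ≼ y × ¬ x ≡ y) → 0 < ρ₂ x y)
    ρ-add      : ∀ x z y → x ≼ z → z ≼ y → ρ₂ x y ≡ ρ₂ x z + ρ₂ z y

  _≺_ : Fin m → Fin m → Set
  x ≺ y = x ≼ y × ¬ x ≡ y

  _≺?_ : Decidable _≺_
  x ≺? y = (x ≼? y) ×-dec ¬? (x ≟ᶠ y)

  ρ : Fin m → ℕ
  ρ x = ρ₂ bot x

  rank : ℕ
  rank = ρ top

-- Polynomials with natural-number coefficients, as coefficient lists
-- (constant term first).

Poly : Set
Poly = List ℕ

_⊕_ : Poly → Poly → Poly
[] ⊕ q = q
(a ∷ p) ⊕ [] = a ∷ p
(a ∷ p) ⊕ (b ∷ q) = (a + b) ∷ (p ⊕ q)

_⊗_ : Poly → Poly → Poly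
[] ⊗ q = []
(a ∷ p) ⊗ q = map (a *_) q ⊕ (0 ∷ (p ⊗ q))

coeff : Poly → ℕ → ℕ
coeff [] i = 0
coeff (a ∷ p) zero = a
coeff (a ∷ p) (suc i) = coeff p i

-- t (t^{k-1} - 1) / (t - 1) = t + t^2 + ... + t^{k-1}  (for k ≥ 1)
chowWeight : ℕ → Poly
chowWeight k = 0 ∷ replicate (k ∸ 1) 1

module Chow {m : ℕ} (P : WeaklyRankedBoundedPoset m) where
  open WeaklyRankedBoundedPoset P

  -- all strict chains x < p₁ < ... < p_s (listed as [p₁,...,p_s]) of
  -- length at most `fuel`
  chainsAbove : ℕ → Fin m → List (List (Fin m))
  chainsAbove zero x = [] ∷ []
  chainsAbove (suc f) x =
    [] ∷ concatMap (λ y → if does (x ≺? y) then map (y ∷_) (chainsAbove f y) else [])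
                   (allFin m)

  chainTerm : Fin m → List (Fin m) → Poly
  chainTerm x [] = 1 ∷ []
  chainTerm x (y ∷ c) = chowWeight (ρ y ∸ ρ x) ⊗ chainTerm y c

  -- every strict chain in P has at most m elements, so fuel m enumerates
  -- all chains 0̂ = p₀ < p₁ < ... < p_s (each exactly once)
  chowPoly : Poly
  chowPoly = foldr _⊕_ [] (map (chainTerm bot) (chainsAbove m bot))

  -- h(P) = (h_0, ..., h_{n-1}), n = rank (for n = 0 we take (h_0))
  hVector : List ℕ
  hVector = map (coeff chowPoly) (upTo ((rank ∸ 1) + 1))

-- entry of a sequence, 0 beyond its end
at : List ℕ → ℕ → ℕ
at = coeff

-- a monomial in k variables, given by its exponent vector
Monomial : ℕ → Set
Monomial k = Vec ℕ k

degree : ∀ {k} → Monomial k → ℕ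
degree = Vec.sum

_divides_ : ∀ {k} → Monomial k → Monomial k → Set
u divides v = ∀ i → Vec.lookup u i ≤ Vec.lookup v i

record MonomialOrderIdeal (k : ℕ) : Set where
  field
    monomials : List (Monomial k)
    distinct  : Unique monomials
    closed    : ∀ {u v} → v ∈ monomials → u divides v → u ∈ monomials

  numOfDegree : ℕ → ℕ
  numOfDegree d = length (filter (λ u → degree u ≟ d) monomials)

IsHVectorOf : ∀ {k} → List ℕ → MonomialOrderIdeal k → Set
IsHVectorOf h I = ∀ d → MonomialOrderIdeal.numOfDegree I d ≡ at h d

IsOSequence : List ℕ → Set
IsOSequence h = Σ ℕ λ k → Σ (MonomialOrderIdeal k) λ I → IsHVectorOf h I

IsOSequenceℤ : List ℤ → Set
IsOSequenceℤ l = Σ (List ℕ) λ h → map +_ h ≡ l × IsOSequence h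

Δ : List ℕ → List ℤ
Δ h = + 1 ∷ map step (upTo ⌊ e /2⌋)
  where
  e = length h ∸ 1
  prev : ℕ → ℕ
  prev zero = 1
  prev (suc i) = at h (suc i)
  step : ℕ → ℤ
  step i = + at h (suc i) ℤ.- + prev i

IsPalindromic : List ℕ → Set
IsPalindromic h = reverse h ≡ h

IsSISequence : List ℕ → Set
IsSISequence h = (at h 0 ≡ 1) × (0 < length h) × IsPalindromic h × IsOSequenceℤ (Δ h)

module Submission where

-- Write N = ρ(x, 1̂) and band N j = t^j + t^(j+1) + ⋯ + t^(N-1-j), the string of ones of
-- length N - 2j centred in the degrees 0, …, N - 1.  By induction over the interval [x, 1̂],
-- the Chow polynomial of [x, 1̂] equals Σ_{v ∈ I(x)} band N (deg v) for an explicit monomial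
-- order ideal I(x) with 2 deg v < N.  The recursion
--   H_[x,1̂] = 1 + Σ_{x<y} (t + ⋯ + t^(ρ(x,y)-1)) H_[y,1̂]
-- reduces this to the identity
--   (t + ⋯ + t^K) · band N′ j = Σ_{1 ≤ a ≤ min(K, N′-2j)} band (K + 1 + N′) (j + a),
-- so I(x) consists of 1 and the monomials v·y^a with x < y < 1̂, v ∈ I(y) and a in that range.
-- A sum of bands with a common centre is palindromic, and in its lower half it grows from degree
-- d - 1 to d by the number of monomials of degree d; hence Δh(P) is the h-vector of I(0̂).

open import Defs
open import Data.Bool using (true; false; if_then_else_)
open import Data.Empty using (⊥-elim)
open import Data.Fin using (Fin; zero; suc)
open import Data.Fin.Properties using () renaming (_≟_ to _≟ᶠ_)
open import Data.Integer as ℤ using (ℤ)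
import Data.Integer.Properties as ℤ
open import Data.List
  using (List; []; _∷_; _++_; _∷ʳ_; map; concatMap; filter; length; upTo; applyUpTo; reverse;
         replicate; foldr; allFin)
open import Data.List.Properties
  using (map-cong; map-∘; map-++; filter-accept; filter-reject; map-upTo; map-applyUpTo;
         length-filter; length-tabulate; applyUpTo-∷ʳ; reverse-++; length-map; length-upTo)
open import Data.List.Membership.Propositional using (_∈_; find; lose)
open import Data.List.Membership.Propositional.Properties
  using (∈-upTo⁻; ∈-concatMap⁻; ∈-concatMap⁺; ∈-applyUpTo⁻; ∈-applyUpTo⁺; ∈-filter⁻; ∈-filter⁺;
         ∈-allFin)
import Data.List.Relation.Unary.All as All
open import Data.List.Relation.Unary.AllPairs using ([]; _∷_)
open import Data.List.Relation.Unary.Any using (here; there)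
open import Data.List.Relation.Unary.Unique.Propositional using (Unique)
open import Data.List.Relation.Unary.Unique.Propositional.Properties
  using (Unique[x∷xs]⇒x∉xs; ++⁺; applyUpTo⁺₁; filter⁺; allFin⁺)
open import Data.List.Relation.Binary.Disjoint.Propositional using (Disjoint)
open import Data.Nat
  using (ℕ; zero; suc; _+_; _*_; _∸_; _≤_; _<_; z≤n; s≤s; z<s; _≤?_; _<?_; _⊓_; ⌊_/2⌋; _≟_)
open import Data.Nat.ListAction using (sum)
open import Data.Nat.ListAction.Properties using (sum-++)
open import Data.Nat.Properties
open import Algebra.Properties.CommutativeSemigroup +-commutativeSemigroup
  using () renaming (interchange to +-interchange)
open import Data.Nat.Tactic.RingSolver using (solve-∀)
open import Data.Product using (_×_; _,_; proj₁; proj₂)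
open import Data.Sum using (_⊎_; inj₁; inj₂)
open import Data.Vec as Vec using (_∷_; []; lookup; _[_]≔_)
open import Data.Vec.Properties
  using (lookup-replicate; lookup∘update; lookup∘update′; []≔-idempotent; []≔-lookup)
open import Function using (_∘_)
open import Level using (0ℓ)
open import Relation.Binary.Definitions using (DecidableEquality; tri<; tri≈; tri>)
open import Relation.Binary.PropositionalEquality hiding (isPartialOrder)
open import Relation.Binary.Structures using (IsPartialOrder)
open import Relation.Nullary using (¬_; Dec; yes; no; does)
open import Relation.Nullary.Decidable using (_×-dec_; ¬?)
open import Relation.Unary using (Pred; Decidable; _⊆_)

if-yes : ∀ {A B : Set} (D : Dec A) {a b : B} → A → (if does D then a else b) ≡ a
if-yes (yes _)  _ = refl
if-yes (no ¬a)  a = ⊥-elim (¬a a)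

if-no : ∀ {A B : Set} (D : Dec A) {a b : B} → ¬ A → (if does D then a else b) ≡ b
if-no (yes a) ¬a = ⊥-elim (¬a a)
if-no (no _)  _  = refl

sum-map-+ : ∀ {A : Set} (f g : A → ℕ) xs →
  sum (map (λ x → f x + g x) xs) ≡ sum (map f xs) + sum (map g xs)
sum-map-+ f g []       = refl
sum-map-+ f g (x ∷ xs) = begin
  f x + g x + sum (map (λ x → f x + g x) xs)     ≡⟨ cong (f x + g x +_) (sum-map-+ f g xs) ⟩
  f x + g x + (sum (map f xs) + sum (map g xs))  ≡⟨ +-interchange (f x) (g x) _ _ ⟩
  f x + sum (map f xs) + (g x + sum (map g xs))  ∎
  where open ≡-Reasoning

sum-map-cong-∈ : ∀ {A : Set} {f g : A → ℕ} xs → (∀ {x} → x ∈ xs → f x ≡ g x) →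
  sum (map f xs) ≡ sum (map g xs)
sum-map-cong-∈ []       eq = refl
sum-map-cong-∈ (x ∷ xs) eq = cong₂ _+_ (eq (here refl)) (sum-map-cong-∈ xs (eq ∘ there))

sum-map-zero : ∀ {A : Set} {f : A → ℕ} xs → (∀ {x} → x ∈ xs → f x ≡ 0) → sum (map f xs) ≡ 0
sum-map-zero []       eq = refl
sum-map-zero (x ∷ xs) eq = cong₂ _+_ (eq (here refl)) (sum-map-zero xs (eq ∘ there))

sum-map-concatMap : ∀ {A B : Set} (f : B → ℕ) (g : A → List B) xs →
  sum (map f (concatMap g xs)) ≡ sum (map (λ x → sum (map f (g x))) xs)
sum-map-concatMap f g []       = refl
sum-map-concatMap f g (x ∷ xs) = begin
  sum (map f (g x ++ concatMap g xs))                ≡⟨ cong sum (map-++ f (g x) _) ⟩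
  sum (map f (g x) ++ map f (concatMap g xs))        ≡⟨ sum-++ (map f (g x)) _ ⟩
  sum (map f (g x)) + sum (map f (concatMap g xs))
    ≡⟨ cong (sum (map f (g x)) +_) (sum-map-concatMap f g xs) ⟩
  sum (map (λ x → sum (map f (g x))) (x ∷ xs))       ∎
  where open ≡-Reasoning

sum-map-if-≟ : ∀ {A : Set} (_≟ᴬ_ : DecidableEquality A) {t : A} (c : ℕ) {xs} → Unique xs → t ∈ xs →
  sum (map (λ y → if does (y ≟ᴬ t) then c else 0) xs) ≡ c
sum-map-if-≟ _≟ᴬ_ {t} c {y ∷ xs} (y∉ ∷ u) (here refl) with y ≟ᴬ y
... | no  y≢y = ⊥-elim (y≢y refl)
... | yes _   = trans (cong (c +_) (sum-map-zero xs absent)) (+-identityʳ c)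
  where
  absent : ∀ {z} → z ∈ xs → (if does (z ≟ᴬ y) then c else 0) ≡ 0
  absent {z} z∈ with z ≟ᴬ y
  ... | yes refl = ⊥-elim (Unique[x∷xs]⇒x∉xs (y∉ ∷ u) z∈)
  ... | no  _    = refl
sum-map-if-≟ _≟ᴬ_ {t} c {y ∷ xs} (y∉ ∷ u) (there t∈) with y ≟ᴬ t
... | yes refl = ⊥-elim (Unique[x∷xs]⇒x∉xs (y∉ ∷ u) t∈)
... | no  _    = sum-map-if-≟ _≟ᴬ_ c u t∈

sum-map-filter : ∀ {A : Set} {P : Pred A 0ℓ} (P? : Decidable P) (g : A → ℕ) xs →
  sum (map g (filter P? xs)) ≡ sum (map (λ x → if does (P? x) then g x else 0) xs)
sum-map-filter P? g []       = refl
sum-map-filter P? g (x ∷ xs) with P? x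
... | yes _ = cong (g x +_) (sum-map-filter P? g xs)
... | no  _ = sum-map-filter P? g xs

concatMap-unique : ∀ {A B : Set} (g : A → List B) {xs} → Unique xs → (∀ {x} → x ∈ xs → Unique (g x)) →
  (∀ {x x′ w} → x ∈ xs → x′ ∈ xs → w ∈ g x → w ∈ g x′ → x ≡ x′) → Unique (concatMap g xs)
concatMap-unique g {[]}     _           _      _     = []
concatMap-unique g {x ∷ xs} (x∉ ∷ uniq) g-uniq g-key =
  ++⁺ (g-uniq (here refl))
      (concatMap-unique g uniq (g-uniq ∘ there) (λ p q → g-key (there p) (there q)))
      disjoint
  where
  disjoint : Disjoint (g x) (concatMap g xs)
  disjoint (w∈gx , w∈rest) with find (∈-concatMap⁻ g w∈rest)
  ... | x′ , x′∈ , w∈gx′ with g-key (here refl) (there x′∈) w∈gx w∈gx′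
  ... | refl = Unique[x∷xs]⇒x∉xs (x∉ ∷ uniq) x′∈

length-filter-mono : ∀ {A : Set} {P Q : Pred A 0ℓ} (P? : Decidable P) (Q? : Decidable Q) → P ⊆ Q →
  ∀ xs → length (filter P? xs) ≤ length (filter Q? xs)
length-filter-mono P? Q? P⊆Q []       = z≤n
length-filter-mono P? Q? P⊆Q (x ∷ xs) with P? x | Q? x
... | yes _  | yes _  = s≤s (length-filter-mono P? Q? P⊆Q xs)
... | yes px | no ¬qx = ⊥-elim (¬qx (P⊆Q px))
... | no  _  | yes _  = m≤n⇒m≤1+n (length-filter-mono P? Q? P⊆Q xs)
... | no  _  | no  _  = length-filter-mono P? Q? P⊆Q xs

length-filter-strict : ∀ {A : Set} {P Q : Pred A 0ℓ} (P? : Decidable P) (Q? : Decidable Q) → P ⊆ Q →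
  ∀ {z xs} → z ∈ xs → Q z → ¬ P z → length (filter P? xs) < length (filter Q? xs)
length-filter-strict P? Q? P⊆Q {xs = x ∷ xs} (here refl) qz ¬pz with P? x | Q? x
... | yes px | _     = ⊥-elim (¬pz px)
... | no  _  | no ¬q = ⊥-elim (¬q qz)
... | no  _  | yes _ = s≤s (length-filter-mono P? Q? P⊆Q xs)
length-filter-strict P? Q? P⊆Q {xs = x ∷ xs} (there z∈) qz ¬pz with P? x | Q? x
... | yes _  | yes _  = s≤s (length-filter-strict P? Q? P⊆Q z∈ qz ¬pz)
... | yes px | no ¬qx = ⊥-elim (¬qx (P⊆Q px))
... | no  _  | yes _  = m≤n⇒m≤1+n (length-filter-strict P? Q? P⊆Q z∈ qz ¬pz)
... | no  _  | no  _  = length-filter-strict P? Q? P⊆Q z∈ qz ¬pz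

δ : ℕ → ℕ → ℕ
δ zero    zero    = 1
δ zero    (suc _) = 0
δ (suc _) zero    = 0
δ (suc a) (suc b) = δ a b

δ-refl : ∀ a → δ a a ≡ 1
δ-refl zero    = refl
δ-refl (suc a) = δ-refl a

δ-≢ : ∀ {a b} → a ≢ b → δ a b ≡ 0
δ-≢ {zero}  {zero}  a≢b = ⊥-elim (a≢b refl)
δ-≢ {zero}  {suc b} a≢b = refl
δ-≢ {suc a} {zero}  a≢b = refl
δ-≢ {suc a} {suc b} a≢b = δ-≢ (a≢b ∘ cong suc)

length-filter-≟ : ∀ {A : Set} (f : A → ℕ) d xs →
  length (filter (λ x → f x ≟ d) xs) ≡ sum (map (λ x → δ (f x) d) xs)
length-filter-≟ f d []       = refl
length-filter-≟ f d (x ∷ xs) with f x ≟ d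
... | yes refl = trans (cong length (filter-accept (λ x → f x ≟ d) refl))
                       (cong₂ _+_ (sym (δ-refl (f x))) (length-filter-≟ f d xs))
... | no  fx≢d = trans (cong length (filter-reject (λ x → f x ≟ d) fx≢d))
                       (trans (length-filter-≟ f d xs) (cong (_+ _) (sym (δ-≢ fx≢d))))

-- Polynomials in t as coefficient functions ℕ → ℕ: shift multiplies by t, ones L is
-- 1 + t + ⋯ + t^(L-1), and onesTimes K, weightTimes k multiply by 1 + t + ⋯ + t^(K-1)
-- and t + ⋯ + t^(k-1) respectively.

_⊞_ : (ℕ → ℕ) → (ℕ → ℕ) → ℕ → ℕ
(F ⊞ G) d = F d + G d

sumSeq : ∀ {A : Set} → List A → (A → ℕ → ℕ) → ℕ → ℕ
sumSeq xs H d = sum (map (λ x → H x d) xs)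

sumSeq-cong-∈ : ∀ {A : Set} {H K : A → ℕ → ℕ} xs → (∀ {x} → x ∈ xs → H x ≗ K x) → sumSeq xs H ≗ sumSeq xs K
sumSeq-cong-∈ xs eq d = sum-map-cong-∈ xs (λ x∈ → eq x∈ d)

shift : (ℕ → ℕ) → ℕ → ℕ
shift F zero    = 0
shift F (suc d) = F d

shift^ : ℕ → (ℕ → ℕ) → ℕ → ℕ
shift^ zero    F = F
shift^ (suc j) F = shift (shift^ j F)

ones : ℕ → ℕ → ℕ
ones zero    d       = 0
ones (suc L) zero    = 1
ones (suc L) (suc d) = ones L d

onesTimes : ℕ → (ℕ → ℕ) → ℕ → ℕ
onesTimes zero    F d = 0
onesTimes (suc K) F d = F d + shift (onesTimes K F) d

weightTimes : ℕ → (ℕ → ℕ) → ℕ → ℕ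
weightTimes k F = shift (onesTimes (k ∸ 1) F)

record Linear (Φ : (ℕ → ℕ) → ℕ → ℕ) : Set where
  field
    cong-≗ : ∀ {F G} → F ≗ G → Φ F ≗ Φ G
    zero-≗ : Φ (λ _ → 0) ≗ (λ _ → 0)
    ⊞-≗    : ∀ F G → Φ (F ⊞ G) ≗ Φ F ⊞ Φ G

  sumSeq-≗ : ∀ {A : Set} (xs : List A) (H : A → ℕ → ℕ) → Φ (sumSeq xs H) ≗ sumSeq xs (Φ ∘ H)
  sumSeq-≗ []       H = zero-≗
  sumSeq-≗ (x ∷ xs) H d = trans (⊞-≗ (H x) (sumSeq xs H) d) (cong (Φ (H x) d +_) (sumSeq-≗ xs H d))

open Linear

shift-linear : Linear shift
shift-linear .cong-≗ eq zero    = refl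
shift-linear .cong-≗ eq (suc d) = eq d
shift-linear .zero-≗ zero    = refl
shift-linear .zero-≗ (suc d) = refl
shift-linear .⊞-≗ F G zero    = refl
shift-linear .⊞-≗ F G (suc d) = refl

∘-linear : ∀ {Φ Ψ} → Linear Φ → Linear Ψ → Linear (Φ ∘ Ψ)
∘-linear lΦ lΨ .cong-≗ eq = lΦ .cong-≗ (lΨ .cong-≗ eq)
∘-linear lΦ lΨ .zero-≗ d  = trans (lΦ .cong-≗ (lΨ .zero-≗) d) (lΦ .zero-≗ d)
∘-linear {Ψ = Ψ} lΦ lΨ .⊞-≗ F G d = trans (lΦ .cong-≗ (lΨ .⊞-≗ F G) d) (lΦ .⊞-≗ (Ψ F) (Ψ G) d)

shift^-linear : ∀ j → Linear (shift^ j)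
shift^-linear zero    .cong-≗ eq = eq
shift^-linear zero    .zero-≗ d  = refl
shift^-linear zero    .⊞-≗ F G d = refl
shift^-linear (suc j) = ∘-linear shift-linear (shift^-linear j)

onesTimes-linear : ∀ K → Linear (onesTimes K)
onesTimes-linear zero    .cong-≗ eq d = refl
onesTimes-linear zero    .zero-≗ d    = refl
onesTimes-linear zero    .⊞-≗ F G d   = refl
onesTimes-linear (suc K) .cong-≗ eq d =
  cong₂ _+_ (eq d) (shift-linear .cong-≗ (onesTimes-linear K .cong-≗ eq) d)
onesTimes-linear (suc K) .zero-≗ d =
  trans (shift-linear .cong-≗ (onesTimes-linear K .zero-≗) d) (shift-linear .zero-≗ d)
onesTimes-linear (suc K) .⊞-≗ F G d = begin
  F d + G d + shift (onesTimes K (F ⊞ G)) d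
    ≡⟨ cong (F d + G d +_) (∘-linear shift-linear (onesTimes-linear K) .⊞-≗ F G d) ⟩
  F d + G d + (shift (onesTimes K F) d + shift (onesTimes K G) d)
    ≡⟨ +-interchange (F d) (G d) _ _ ⟩
  F d + shift (onesTimes K F) d + (G d + shift (onesTimes K G) d) ∎
  where open ≡-Reasoning

weightTimes-linear : ∀ k → Linear (weightTimes k)
weightTimes-linear k = ∘-linear shift-linear (onesTimes-linear (k ∸ 1))

-- Products of strings of ones

shift^-+ : ∀ i j F → shift^ i (shift^ j F) ≗ shift^ (i + j) F
shift^-+ zero    j F d = refl
shift^-+ (suc i) j F   = shift-linear .cong-≗ (shift^-+ i j F)

ones-suc : ∀ L → ones (suc L) ≗ ones 1 ⊞ shift (ones L)
ones-suc L zero    = refl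
ones-suc L (suc d) = refl

ones-+ : ∀ L K → ones (L + K) ≗ ones L ⊞ shift^ L (ones K)
ones-+ zero    K d       = refl
ones-+ (suc L) K zero    = refl
ones-+ (suc L) K (suc d) = ones-+ L K d

onesTimes-shift : ∀ K F → onesTimes K (shift F) ≗ shift (onesTimes K F)
onesTimes-shift zero    F d = sym (shift-linear .zero-≗ d)
onesTimes-shift (suc K) F d = trans (cong (shift F d +_) (shift-linear .cong-≗ (onesTimes-shift K F) d))
                                    (sym (shift-linear .⊞-≗ F _ d))

onesTimes-shift^ : ∀ K j F → onesTimes K (shift^ j F) ≗ shift^ j (onesTimes K F)
onesTimes-shift^ K zero    F d = refl
onesTimes-shift^ K (suc j) F d = trans (onesTimes-shift K (shift^ j F) d)
                                       (shift-linear .cong-≗ (onesTimes-shift^ K j F) d)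

onesTimes-one : ∀ K → onesTimes K (ones 1) ≗ ones K
onesTimes-one zero    d = refl
onesTimes-one (suc K) d = trans (cong (ones 1 d +_) (shift-linear .cong-≗ (onesTimes-one K) d))
                                (sym (ones-suc K d))

ones-weightTimes-one : ∀ {N} → 0 < N → ones N ≗ ones 1 ⊞ weightTimes N (ones 1)
ones-weightTimes-one {suc n} _ d =
  trans (ones-suc n d) (cong (ones 1 d +_) (shift-linear .cong-≗ (sym ∘ onesTimes-one n) d))

onesTimes-ones-suc : ∀ K L → onesTimes K (ones (suc L)) ≗ onesTimes K (ones L) ⊞ shift^ L (ones K)
onesTimes-ones-suc K L d = begin
  onesTimes K (ones (suc L)) d
    ≡⟨ onesTimes-linear K .cong-≗ ones-suc′ d ⟩
  onesTimes K (ones L ⊞ shift^ L (ones 1)) d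
    ≡⟨ onesTimes-linear K .⊞-≗ (ones L) _ d ⟩
  onesTimes K (ones L) d + onesTimes K (shift^ L (ones 1)) d
    ≡⟨ cong (onesTimes K (ones L) d +_) (onesTimes-shift^ K L (ones 1) d) ⟩
  onesTimes K (ones L) d + shift^ L (onesTimes K (ones 1)) d
    ≡⟨ cong (onesTimes K (ones L) d +_) (shift^-linear L .cong-≗ (onesTimes-one K) d) ⟩
  onesTimes K (ones L) d + shift^ L (ones K) d ∎
  where
  open ≡-Reasoning
  ones-suc′ : ones (suc L) ≗ ones L ⊞ shift^ L (ones 1)
  ones-suc′ e = trans (cong (λ n → ones n e) (+-comm 1 L)) (ones-+ L 1 e)

onesTimes-ones-suc-suc : ∀ K L →
  onesTimes (suc K) (ones (suc L)) ≗ ones (suc (K + L)) ⊞ shift (onesTimes K (ones L))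
onesTimes-ones-suc-suc K L d = begin
  ones (suc L) d + shift (onesTimes K (ones (suc L))) d
    ≡⟨ cong (ones (suc L) d +_) (shift-linear .cong-≗ (onesTimes-ones-suc K L) d) ⟩
  ones (suc L) d + shift (onesTimes K (ones L) ⊞ shift^ L (ones K)) d
    ≡⟨ cong (ones (suc L) d +_) (shift-linear .⊞-≗ (onesTimes K (ones L)) _ d) ⟩
  ones (suc L) d + (shift (onesTimes K (ones L)) d + shift^ (suc L) (ones K) d)
    ≡⟨ rearrange (ones (suc L) d) _ _ ⟩
  ones (suc L) d + shift^ (suc L) (ones K) d + shift (onesTimes K (ones L)) d
    ≡⟨ cong (_+ shift (onesTimes K (ones L)) d) (sym (ones-+ (suc L) K d)) ⟩
  ones (suc L + K) d + shift (onesTimes K (ones L)) d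
    ≡⟨ cong (λ n → ones (suc n) d + shift (onesTimes K (ones L)) d) (+-comm L K) ⟩
  ones (suc (K + L)) d + shift (onesTimes K (ones L)) d ∎
  where
  open ≡-Reasoning
  rearrange : ∀ a b c → a + (b + c) ≡ a + c + b
  rearrange = solve-∀

band : ℕ → ℕ → ℕ → ℕ
band N j = shift^ j (ones (N ∸ (j + j)))

onesTimes-ones : ∀ K L → onesTimes K (ones L) ≗ sumSeq (upTo (K ⊓ L)) (band (K + L ∸ 1))
onesTimes-ones zero    L       d = refl
onesTimes-ones (suc K) zero    d = onesTimes-linear (suc K) .zero-≗ d
onesTimes-ones (suc K) (suc L) d = begin
  onesTimes (suc K) (ones (suc L)) d
    ≡⟨ onesTimes-ones-suc-suc K L d ⟩
  ones (suc (K + L)) d + shift (onesTimes K (ones L)) d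
    ≡⟨ cong₂ _+_ (cong (λ n → ones n d) (sym (+-suc K L)))
                 (shift-linear .cong-≗ (onesTimes-ones K L) d) ⟩
  ones (K + suc L) d + shift (sumSeq (upTo (K ⊓ L)) (band (K + L ∸ 1))) d
    ≡⟨ cong (ones (K + suc L) d +_) (sumSeq-≗ shift-linear (upTo (K ⊓ L)) _ d) ⟩
  ones (K + suc L) d + sumSeq (upTo (K ⊓ L)) (shift ∘ band (K + L ∸ 1)) d
    ≡⟨ cong (ones (K + suc L) d +_) (sum-map-cong-∈ (upTo (K ⊓ L)) (λ {i} _ → shift-band i d)) ⟩
  ones (K + suc L) d + sum (map (λ i → band (K + suc L) (suc i) d) (upTo (K ⊓ L)))
    ≡⟨ cong (λ s → ones (K + suc L) d + sum s)
            (trans (map-upTo _ (K ⊓ L)) (sym (map-applyUpTo suc _ (K ⊓ L)))) ⟩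
  sumSeq (upTo (suc (K ⊓ L))) (band (K + suc L)) d ∎
  where
  open ≡-Reasoning
  shift-band : ∀ i → shift (band (K + L ∸ 1) i) ≗ band (K + suc L) (suc i)
  shift-band i e = cong (λ n → shift^ (suc i) (ones n) e) (begin
    K + L ∸ 1 ∸ (i + i)          ≡⟨ ∸-+-assoc (K + L) 1 (i + i) ⟩
    K + L ∸ suc (i + i)          ≡⟨ cong (K + L ∸_) (sym (+-suc i i)) ⟩
    suc (K + L) ∸ (suc i + suc i) ≡⟨ cong (_∸ (suc i + suc i)) (sym (+-suc K L)) ⟩
    K + suc L ∸ (suc i + suc i)  ∎)

weightTimes-band : ∀ K Ny j →
  weightTimes (suc K) (band Ny j) ≗ sumSeq (upTo (K ⊓ (Ny ∸ (j + j)))) (λ a → band (suc K + Ny) (j + suc a))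
weightTimes-band K Ny j d = begin
  shift (onesTimes K (shift^ j (ones L))) d
    ≡⟨ shift-linear .cong-≗ (onesTimes-shift^ K j (ones L)) d ⟩
  shift^ (suc j) (onesTimes K (ones L)) d
    ≡⟨ shift^-linear (suc j) .cong-≗ (onesTimes-ones K L) d ⟩
  shift^ (suc j) (sumSeq (upTo (K ⊓ L)) (band (K + L ∸ 1))) d
    ≡⟨ sumSeq-≗ (shift^-linear (suc j)) (upTo (K ⊓ L)) _ d ⟩
  sumSeq (upTo (K ⊓ L)) (shift^ (suc j) ∘ band (K + L ∸ 1)) d
    ≡⟨ sumSeq-cong-∈ (upTo (K ⊓ L)) (λ i∈ → shift-band (∈-upTo⁻ i∈)) d ⟩
  sumSeq (upTo (K ⊓ L)) (λ a → band (suc K + Ny) (j + suc a)) d ∎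
  where
  open ≡-Reasoning
  L = Ny ∸ (j + j)
  length-eq : ∀ i → K + L ∸ 1 ∸ (i + i) ≡ suc K + ((j + j) + L) ∸ ((j + suc i) + (j + suc i))
  length-eq i = begin
    K + L ∸ 1 ∸ (i + i)                                    ≡⟨ ∸-+-assoc (K + L) 1 (i + i) ⟩
    suc (K + L) ∸ suc (suc (i + i))                        ≡⟨ [m+n]∸[m+o]≡n∸o (j + j) _ _ ⟨
    (j + j) + suc (K + L) ∸ ((j + j) + suc (suc (i + i)))  ≡⟨ cong₂ _∸_ (regroup₁ j K L) (regroup₂ j i) ⟩
    suc K + ((j + j) + L) ∸ ((j + suc i) + (j + suc i))   ∎
    where
    regroup₁ : ∀ j K L → (j + j) + suc (K + L) ≡ suc K + ((j + j) + L)
    regroup₁ = solve-∀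
    regroup₂ : ∀ j i → (j + j) + suc (suc (i + i)) ≡ (j + suc i) + (j + suc i)
    regroup₂ = solve-∀
  shift-band : ∀ {i} → i < K ⊓ L → shift^ (suc j) (band (K + L ∸ 1) i) ≗ band (suc K + Ny) (j + suc i)
  shift-band {i} i<r e = begin
    shift^ (suc j) (shift^ i (ones (K + L ∸ 1 ∸ (i + i)))) e
      ≡⟨ shift^-+ (suc j) i _ e ⟩
    shift^ (suc j + i) (ones (K + L ∸ 1 ∸ (i + i))) e
      ≡⟨ cong₂ (λ s n → shift^ s (ones n) e) (sym (+-suc j i)) (length-eq i) ⟩
    shift^ (j + suc i) (ones (suc K + ((j + j) + L) ∸ ((j + suc i) + (j + suc i)))) e
      ≡⟨ cong (λ n → band (suc K + n) (j + suc i) e) (m+[n∸m]≡n 2j≤Ny) ⟩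
    band (suc K + Ny) (j + suc i) e ∎
    where
    2j≤Ny : j + j ≤ Ny
    2j≤Ny = <⇒≤ (m∸n≢0⇒n<m (λ L≡0 → n≮0 (subst (i <_) L≡0 (≤-trans i<r (m⊓n≤n K L)))))

-- Bands

shift^-+ʳ : ∀ j F e → shift^ j F (j + e) ≡ F e
shift^-+ʳ zero    F e = refl
shift^-+ʳ (suc j) F e = shift^-+ʳ j F e

shift^-< : ∀ j F {d} → d < j → shift^ j F d ≡ 0
shift^-< (suc j) F {zero}  _         = refl
shift^-< (suc j) F {suc d} (s≤s d<j) = shift^-< j F d<j

ones-< : ∀ {L e} → e < L → ones L e ≡ 1
ones-< {suc L} {zero}  _         = refl
ones-< {suc L} {suc e} (s≤s e<L) = ones-< e<L

ones-≥ : ∀ {L e} → L ≤ e → ones L e ≡ 0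
ones-≥ {zero}  _         = refl
ones-≥ {suc L} (s≤s L≤e) = ones-≥ L≤e

InBand : ℕ → ℕ → ℕ → Set
InBand N j d = j ≤ d × d + j < N

inBand? : ∀ N j d → Dec (InBand N j d)
inBand? N j d = (j ≤? d) ×-dec (suc (d + j) ≤? N)

band-unshift : ∀ N {j d} → j ≤ d → band N j d ≡ ones (N ∸ (j + j)) (d ∸ j)
band-unshift N {j} {d} j≤d = trans (cong (band N j) (sym (m+[n∸m]≡n j≤d))) (shift^-+ʳ j _ (d ∸ j))

band-inside : ∀ {N j d} → InBand N j d → band N j d ≡ 1
band-inside {N} {j} {d} (j≤d , d+j<N) = trans (band-unshift N j≤d) (ones-< (m+n≤o⇒m≤o∸n (suc (d ∸ j)) fits))
  where
  fits : suc (d ∸ j) + (j + j) ≤ N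
  fits = subst (_< N) (trans (cong (_+ j) (sym (m∸n+n≡m j≤d))) (+-assoc (d ∸ j) j j)) d+j<N

band-outside : ∀ {N j d} → ¬ InBand N j d → band N j d ≡ 0
band-outside {N} {j} {d} ∉band with j ≤? d
... | no  j≰d = shift^-< j _ (≰⇒> j≰d)
... | yes j≤d = trans (band-unshift N j≤d) (ones-≥ (m≤n+o⇒m∸n≤o N (j + j) too-long))
  where
  too-long : N ≤ (j + j) + (d ∸ j)
  too-long = subst (N ≤_) d+j≡ (≮⇒≥ (λ d+j<N → ∉band (j≤d , d+j<N)))
    where
    d+j≡ : d + j ≡ (j + j) + (d ∸ j)
    d+j≡ = trans (cong (_+ j) (sym (m∸n+n≡m j≤d))) (trans (+-assoc (d ∸ j) j j) (+-comm _ (j + j)))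

inBand-reflect : ∀ {n j d} → d ≤ n → InBand (suc n) j d → InBand (suc n) j (n ∸ d)
inBand-reflect {n} {j} {d} d≤n (j≤d , s≤s d+j≤n) =
  m+n≤o⇒m≤o∸n j (subst (_≤ n) (+-comm d j) d+j≤n) ,
  s≤s (subst ((n ∸ d) + j ≤_) (m∸n+n≡m d≤n) (+-monoʳ-≤ (n ∸ d) j≤d))

band-reflect : ∀ n j {d} → d ≤ n → band (suc n) j d ≡ band (suc n) j (n ∸ d)
band-reflect n j {d} d≤n with inBand? (suc n) j d
... | yes inside = trans (band-inside inside) (sym (band-inside (inBand-reflect d≤n inside)))
... | no  outside = trans (band-outside outside) (sym (band-outside (outside ∘ reflect-back)))
  where
  reflect-back : InBand (suc n) j (n ∸ d) → InBand (suc n) j d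
  reflect-back = subst (InBand (suc n) j) (m∸[m∸n]≡n d≤n) ∘ inBand-reflect (m∸n≤m n d)

band-at-0 : ∀ n j → band (suc n) j 0 ≡ δ j 0
band-at-0 n zero    = refl
band-at-0 n (suc j) = refl

band-suc : ∀ N j d → suc (suc d + suc d) ≤ N → band N j (suc d) ≡ band N j d + δ j (suc d)
band-suc N j d short with <-cmp j (suc d)
... | tri< j<sd _ _ = begin
  band N j (suc d)          ≡⟨ band-inside (<⇒≤ j<sd , sd+j<N) ⟩
  1                         ≡⟨ cong₂ _+_ (band-inside (≤-pred j<sd , d+j<N)) (δ-≢ (<⇒≢ j<sd)) ⟨
  band N j d + δ j (suc d)  ∎
  where
  open ≡-Reasoning
  sd+j<N : suc d + j < N
  sd+j<N = <-trans (+-monoʳ-< (suc d) j<sd) short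
  d+j<N : d + j < N
  d+j<N = <-trans (n<1+n (d + j)) sd+j<N
... | tri≈ _ refl _ = trans (band-inside {N} {suc d} {suc d} (≤-refl , short))
                            (sym (cong₂ _+_ (shift^-< (suc d) _ ≤-refl) (δ-refl (suc d))))
... | tri> _ _ sd<j = trans (shift^-< j _ sd<j)
                            (sym (cong₂ _+_ (shift^-< j _ (<-trans (n<1+n d) sd<j)) (δ-≢ (>⇒≢ sd<j))))

at-applyUpTo : ∀ (F : ℕ → ℕ) {X k} → k < X → at (applyUpTo F X) k ≡ F k
at-applyUpTo F {suc X} {zero}  _         = refl
at-applyUpTo F {suc X} {suc k} (s≤s k<X) = at-applyUpTo (F ∘ suc) k<X

at-applyUpTo-≥ : ∀ (F : ℕ → ℕ) {X k} → X ≤ k → at (applyUpTo F X) k ≡ 0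
at-applyUpTo-≥ F {zero}  _         = refl
at-applyUpTo-≥ F {suc X} (s≤s X≤k) = at-applyUpTo-≥ (F ∘ suc) X≤k

applyUpTo-cong-< : ∀ {A : Set} (f g : ℕ → A) n → (∀ {i} → i < n → f i ≡ g i) → applyUpTo f n ≡ applyUpTo g n
applyUpTo-cong-< f g zero    eq = refl
applyUpTo-cong-< f g (suc n) eq = cong₂ _∷_ (eq z<s) (applyUpTo-cong-< (f ∘ suc) (g ∘ suc) n (eq ∘ s≤s))

reverse-applyUpTo : ∀ {A : Set} (f : ℕ → A) n → reverse (applyUpTo f n) ≡ applyUpTo (λ i → f (n ∸ suc i)) n
reverse-applyUpTo f zero    = refl
reverse-applyUpTo f (suc n) = begin
  reverse (applyUpTo f (suc n))              ≡⟨ cong reverse (applyUpTo-∷ʳ f n) ⟨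
  reverse (applyUpTo f n ∷ʳ f n)             ≡⟨ reverse-++ (applyUpTo f n) (f n ∷ []) ⟩
  f n ∷ reverse (applyUpTo f n)              ≡⟨ cong (f n ∷_) (reverse-applyUpTo f n) ⟩
  applyUpTo (λ i → f (suc n ∸ suc i)) (suc n) ∎
  where open ≡-Reasoning

+[m+n]-+m≡+n : ∀ m n → ℤ.+ (m + n) ℤ.- ℤ.+ m ≡ ℤ.+ n
+[m+n]-+m≡+n m n = trans (ℤ.m-n≡m⊖n (m + n) m) (trans (ℤ.⊖-≥ (m≤m+n m n)) (cong ℤ.+_ (m+n∸m≡n m n)))

isSISequence-byIncrements : ∀ n (H : ℕ → ℕ) {k} (I : MonomialOrderIdeal k) →
  let c = MonomialOrderIdeal.numOfDegree I in
  H 0 ≡ 1 → (∀ {d} → d ≤ n → H d ≡ H (n ∸ d)) →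
  (∀ {d} → suc d ≤ ⌊ n /2⌋ → H (suc d) ≡ H d + c (suc d)) →
  c 0 ≡ 1 → (∀ {j} → ⌊ n /2⌋ < j → c j ≡ 0) →
  IsSISequence (map H (upTo (suc n)))
isSISequence-byIncrements n H {k} I H0≡1 H-reflect H-suc c0≡1 c-vanishes =
  H0≡1 , z<s , palindromic , (1 ∷ map (c ∘ suc) (upTo E)) , Δh≡c , (k , I , isHVector)
  where
  c = MonomialOrderIdeal.numOfDegree I
  E = ⌊ n /2⌋
  h = map H (upTo (suc n))
  h≡ : h ≡ applyUpTo H (suc n)
  h≡ = map-upTo H (suc n)
  palindromic : reverse h ≡ h
  palindromic = begin
    reverse h                            ≡⟨ cong reverse h≡ ⟩
    reverse (applyUpTo H (suc n))        ≡⟨ reverse-applyUpTo H (suc n) ⟩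
    applyUpTo (λ i → H (n ∸ i)) (suc n)
      ≡⟨ applyUpTo-cong-< _ H (suc n) (sym ∘ H-reflect ∘ ≤-pred) ⟩
    applyUpTo H (suc n)                  ≡⟨ h≡ ⟨
    h                                    ∎
    where open ≡-Reasoning
  h-at : ∀ {j} → j ≤ n → at h j ≡ H j
  h-at {j} j≤n = trans (cong (λ l → at l j) h≡) (at-applyUpTo H (s≤s j≤n))
  isHVector : IsHVectorOf (1 ∷ map (c ∘ suc) (upTo E)) I
  isHVector zero    = c0≡1
  isHVector (suc i) with i <? E
  ... | yes i<E = sym (trans (cong (λ l → at l i) (map-upTo (c ∘ suc) E)) (at-applyUpTo (c ∘ suc) i<E))
  ... | no  i≮E = trans (c-vanishes (s≤s (≮⇒≥ i≮E)))
    (sym (trans (cong (λ l → at l i) (map-upTo (c ∘ suc) E)) (at-applyUpTo-≥ (c ∘ suc) (≮⇒≥ i≮E))))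
  ≤E⇒≤n : ∀ {j} → j ≤ E → j ≤ n
  ≤E⇒≤n j≤E = ≤-trans j≤E (⌊n/2⌋≤n n)
  Δ-entries : ∀ {X} (g : ℕ → ℤ) → X ≡ E → (∀ {i} → i < E → ℤ.+ c (suc i) ≡ g i) →
              map (ℤ.+_ ∘ c ∘ suc) (upTo E) ≡ map g (upTo X)
  Δ-entries g refl eq = trans (map-upTo _ E) (trans (applyUpTo-cong-< _ g E eq) (sym (map-upTo g E)))
  length-h : length h ∸ 1 ≡ n
  length-h = cong (_∸ 1) (trans (length-map H (upTo (suc n))) (length-upTo (suc n)))
  Δh≡c : map ℤ.+_ (1 ∷ map (c ∘ suc) (upTo E)) ≡ Δ h
  Δh≡c = cong (ℤ.+ 1 ∷_)
    (trans (sym (map-∘ (upTo E))) (Δ-entries _ (cong ⌊_/2⌋ length-h) λ { {zero} → Δ₀ ; {suc i} → Δₛ }))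
    where
    Δ₀ : 0 < E → ℤ.+ c 1 ≡ ℤ.+ at h 1 ℤ.- ℤ.+ 1
    Δ₀ 0<E = sym (trans (cong (λ a → ℤ.+ a ℤ.- ℤ.+ 1) h₁≡) (+[m+n]-+m≡+n 1 (c 1)))
      where
      h₁≡ : at h 1 ≡ 1 + c 1
      h₁≡ = trans (h-at (≤E⇒≤n 0<E)) (trans (H-suc 0<E) (cong (_+ c 1) H0≡1))
    Δₛ : ∀ {i} → suc i < E → ℤ.+ c (suc (suc i)) ≡ ℤ.+ at h (suc (suc i)) ℤ.- ℤ.+ at h (suc i)
    Δₛ {i} si<E = sym (trans (cong₂ (λ a b → ℤ.+ a ℤ.- ℤ.+ b) hₛₛ≡ (h-at (≤E⇒≤n (<⇒≤ si<E))))
                             (+[m+n]-+m≡+n (H (suc i)) (c (suc (suc i)))))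
      where
      hₛₛ≡ : at h (suc (suc i)) ≡ H (suc i) + c (suc (suc i))
      hₛₛ≡ = trans (h-at (≤E⇒≤n si<E)) (H-suc si<E)

bandSum : ∀ {k} → ℕ → List (Monomial k) → ℕ → ℕ
bandSum N vs = sumSeq vs (band N ∘ degree)

double≤⇒≤half : ∀ {j n} → j + j ≤ n → j ≤ ⌊ n /2⌋
double≤⇒≤half {j} j+j≤n = subst (_≤ _) (sym (n≡⌊n+n/2⌋ j)) (⌊n/2⌋-mono j+j≤n)

half+half≤ : ∀ n → ⌊ n /2⌋ + ⌊ n /2⌋ ≤ n
half+half≤ n = subst (⌊ n /2⌋ + ⌊ n /2⌋ ≤_) (⌊n/2⌋+⌈n/2⌉≡n n) (+-monoʳ-≤ ⌊ n /2⌋ (⌊n/2⌋≤⌈n/2⌉ n))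

isSISequence-bandSum : ∀ n {k} (I : MonomialOrderIdeal k) → let open MonomialOrderIdeal I in
  numOfDegree 0 ≡ 1 → (∀ {v} → v ∈ monomials → degree v + degree v ≤ n) →
  IsSISequence (map (bandSum (suc n) monomials) (upTo (suc n)))
isSISequence-bandSum n I c0≡1 short = isSISequence-byIncrements n H I H0≡1 H-reflect H-suc c0≡1 c-vanishes
  where
  open MonomialOrderIdeal I
  H = bandSum (suc n) monomials
  count : ∀ d → numOfDegree d ≡ sum (map (λ v → δ (degree v) d) monomials)
  count d = length-filter-≟ degree d monomials
  H0≡1 : H 0 ≡ 1
  H0≡1 = trans (sum-map-cong-∈ monomials (λ {v} _ → band-at-0 n (degree v))) (trans (sym (count 0)) c0≡1)
  H-reflect : ∀ {d} → d ≤ n → H d ≡ H (n ∸ d)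
  H-reflect d≤n = sum-map-cong-∈ monomials (λ {v} _ → band-reflect n (degree v) d≤n)
  H-suc : ∀ {d} → suc d ≤ ⌊ n /2⌋ → H (suc d) ≡ H d + numOfDegree (suc d)
  H-suc {d} sd≤E = begin
    H (suc d)
      ≡⟨ sum-map-cong-∈ monomials (λ {v} _ → band-suc (suc n) (degree v) d in-lower-half) ⟩
    sum (map (λ v → band (suc n) (degree v) d + δ (degree v) (suc d)) monomials)
      ≡⟨ sum-map-+ (λ v → band (suc n) (degree v) d) _ monomials ⟩
    H d + sum (map (λ v → δ (degree v) (suc d)) monomials)
      ≡⟨ cong (H d +_) (count (suc d)) ⟨
    H d + numOfDegree (suc d) ∎
    where
    open ≡-Reasoning
    in-lower-half : suc (suc d + suc d) ≤ suc n
    in-lower-half = s≤s (≤-trans (+-mono-≤ sd≤E sd≤E) (half+half≤ n))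
  c-vanishes : ∀ {j} → ⌊ n /2⌋ < j → numOfDegree j ≡ 0
  c-vanishes {j} E<j = trans (count j) (sum-map-zero monomials (λ {v} v∈ →
    δ-≢ (λ deg≡j → <⇒≱ E<j (subst (_≤ ⌊ n /2⌋) deg≡j (double≤⇒≤half {degree v} (short v∈))))))

coeff-⊕ : ∀ p q → coeff (p ⊕ q) ≗ coeff p ⊞ coeff q
coeff-⊕ []      q       d       = refl
coeff-⊕ (a ∷ p) []      d       = sym (+-identityʳ _)
coeff-⊕ (a ∷ p) (b ∷ q) zero    = refl
coeff-⊕ (a ∷ p) (b ∷ q) (suc d) = coeff-⊕ p q d

coeff-foldr-⊕ : ∀ ps → coeff (foldr _⊕_ [] ps) ≗ sumSeq ps coeff
coeff-foldr-⊕ []       d = refl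
coeff-foldr-⊕ (p ∷ ps) d = trans (coeff-⊕ p _ d) (cong (coeff p d +_) (coeff-foldr-⊕ ps d))

coeff-map-* : ∀ a q d → coeff (map (a *_) q) d ≡ a * coeff q d
coeff-map-* a []      d       = sym (*-zeroʳ a)
coeff-map-* a (b ∷ q) zero    = refl
coeff-map-* a (b ∷ q) (suc d) = coeff-map-* a q d

coeff-0∷ : ∀ p → coeff (0 ∷ p) ≗ shift (coeff p)
coeff-0∷ p zero    = refl
coeff-0∷ p (suc d) = refl

coeff-replicate-⊗ : ∀ K q → coeff (replicate K 1 ⊗ q) ≗ onesTimes K (coeff q)
coeff-replicate-⊗ zero    q d = refl
coeff-replicate-⊗ (suc K) q d = trans (coeff-⊕ (map (1 *_) q) _ d)
  (cong₂ _+_ (trans (coeff-map-* 1 q d) (*-identityˡ _))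
             (trans (coeff-0∷ _ d) (shift-linear .cong-≗ (coeff-replicate-⊗ K q) d)))

coeff-chowWeight-⊗ : ∀ k q → coeff (chowWeight k ⊗ q) ≗ weightTimes k (coeff q)
coeff-chowWeight-⊗ k q d = trans (coeff-⊕ (map (0 *_) q) _ d)
  (trans (cong (_+ coeff (0 ∷ (replicate (k ∸ 1) 1 ⊗ q)) d) (coeff-map-* 0 q d))
         (trans (coeff-0∷ (replicate (k ∸ 1) 1 ⊗ q) d)
                (shift-linear .cong-≗ (coeff-replicate-⊗ (k ∸ 1) q) d)))

coeff-one : coeff (1 ∷ []) ≗ ones 1
coeff-one zero    = refl
coeff-one (suc d) = refl

degree-replicate-0 : ∀ n → degree (Vec.replicate n 0) ≡ 0
degree-replicate-0 zero    = refl
degree-replicate-0 (suc n) = degree-replicate-0 n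

degree-[]≔ : ∀ {n} (v : Monomial n) i a → lookup v i ≡ 0 → degree (v [ i ]≔ a) ≡ degree v + a
degree-[]≔ (b ∷ v) zero    a refl = +-comm a (degree v)
degree-[]≔ (b ∷ v) (suc i) a vᵢ≡0 =
  trans (cong (b +_) (degree-[]≔ v i a vᵢ≡0)) (sym (+-assoc b (degree v) a))

degree-mono : ∀ {n} (u v : Monomial n) → u divides v → degree u ≤ degree v
degree-mono []      []      u|v = z≤n
degree-mono (a ∷ u) (b ∷ v) u|v = +-mono-≤ (u|v zero) (degree-mono u v (u|v ∘ suc))

divides-replicate-0 : ∀ {n} {u : Monomial n} → u divides Vec.replicate n 0 → u ≡ Vec.replicate n 0
divides-replicate-0 {u = []}    u|0 = refl
divides-replicate-0 {u = a ∷ u} u|0 with u|0 zero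
... | z≤n = cong (0 ∷_) (divides-replicate-0 (u|0 ∘ suc))

-- The Chow polynomial as a sum over chains

module Chains {m : ℕ} (P : WeaklyRankedBoundedPoset m) where
  open WeaklyRankedBoundedPoset P
  open Chow P
  open IsPartialOrder isPartialOrder using (antisym) renaming (refl to ≼-refl; trans to ≼-trans)

  ≺-irrefl : ∀ {x} → ¬ x ≺ x
  ≺-irrefl (_ , x≢x) = x≢x refl

  ≺-≼-trans : ∀ {x y z} → x ≺ y → y ≼ z → x ≺ z
  ≺-≼-trans (x≼y , x≢y) y≼z = ≼-trans x≼y y≼z , λ { refl → x≢y (antisym x≼y y≼z) }

  ≺-trans : ∀ {x y z} → x ≺ y → y ≺ z → x ≺ z
  ≺-trans x≺y (y≼z , _) = ≺-≼-trans x≺y y≼z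

  top-maximal : ∀ {y} → ¬ top ≺ y
  top-maximal {y} (top≼y , top≢y) = top≢y (antisym top≼y (top-greatest y))

  ρ₂-positive : ∀ {x y} → x ≺ y → 0 < ρ₂ x y
  ρ₂-positive {x} {y} = proj₂ (ρ-pos x y)

  ρ-∸ : ∀ {x y} → x ≼ y → ρ y ∸ ρ x ≡ ρ₂ x y
  ρ-∸ {x} {y} x≼y = trans (cong (_∸ ρ x) (ρ-add bot x y (bot-least x) x≼y)) (m+n∸m≡n (ρ x) (ρ₂ x y))

  suc-ρ₂-∸1 : ∀ {x y} → x ≺ y → suc (ρ₂ x y ∸ 1) ≡ ρ₂ x y
  suc-ρ₂-∸1 x≺y = trans (+-comm 1 _) (m∸n+n≡m (ρ₂-positive x≺y))

  ρ₂-split : ∀ {x y} → x ≺ y → ρ₂ x top ≡ suc (ρ₂ x y ∸ 1) + ρ₂ y top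
  ρ₂-split {x} {y} x≺y =
    trans (ρ-add x y top (proj₁ x≺y) (top-greatest y)) (cong (_+ ρ₂ y top) (sym (suc-ρ₂-∸1 x≺y)))

  rank≡0⇒bot≡top : rank ≡ 0 → bot ≡ top
  rank≡0⇒bot≡top rank≡0 with bot ≟ᶠ top
  ... | yes bot≡top = bot≡top
  ... | no  bot≢top = ⊥-elim (n≮0 (subst (0 <_) rank≡0 (ρ₂-positive (bot-least top , bot≢top))))

  rank≡suc⇒bot≺top : ∀ {n} → rank ≡ suc n → bot ≺ top
  rank≡suc⇒bot≺top rank≡ = proj₁ (ρ-pos bot top) (subst (0 <_) (sym rank≡) z<s)

  -- bounds the length of the strict chains starting at x, hence the fuel chainsAbove needs
  upSize : Fin m → ℕ
  upSize x = length (filter (x ≼?_) (allFin m))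

  upSize-< : ∀ {x y} → x ≺ y → upSize y < upSize x
  upSize-< (x≼y , x≢y) =
    length-filter-strict (_ ≼?_) (_ ≼?_) (≼-trans x≼y) (∈-allFin _) ≼-refl (x≢y ∘ antisym x≼y)

  upSize≤m : ∀ x → upSize x ≤ m
  upSize≤m x = subst (upSize x ≤_) (length-tabulate (λ i → i)) (length-filter (x ≼?_) (allFin m))

  chainSum : ℕ → Fin m → ℕ → ℕ
  chainSum f x = sumSeq (chainsAbove f x) (coeff ∘ chainTerm x)

  coeff-chowPoly : coeff chowPoly ≗ chainSum m bot
  coeff-chowPoly d = trans (coeff-foldr-⊕ (map (chainTerm bot) (chainsAbove m bot)) d)
                           (cong sum (sym (map-∘ (chainsAbove m bot))))

  chainSum-suc : ∀ f x d → chainSum (suc f) x d ≡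
    ones 1 d + sum (map (λ y → if does (x ≺? y) then weightTimes (ρ y ∸ ρ x) (chainSum f y) d else 0)
                        (allFin m))
  chainSum-suc f x d = cong₂ _+_ (coeff-one d)
    (trans (sum-map-concatMap _ _ (allFin m)) (sum-map-cong-∈ (allFin m) (λ {y} _ → first-step y)))
    where
    termCoeff : Fin m → List (Fin m) → ℕ
    termCoeff x c = coeff (chainTerm x c) d
    first-step : ∀ y →
      sum (map (termCoeff x) (if does (x ≺? y) then map (y ∷_) (chainsAbove f y) else [])) ≡
      (if does (x ≺? y) then weightTimes (ρ y ∸ ρ x) (chainSum f y) d else 0)
    first-step y with does (x ≺? y)
    ... | false = refl
    ... | true  = begin
      sum (map (termCoeff x) (map (y ∷_) (chainsAbove f y)))
        ≡⟨ cong sum (map-∘ (chainsAbove f y)) ⟨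
      sumSeq (chainsAbove f y) (λ c → coeff (chowWeight (ρ y ∸ ρ x) ⊗ chainTerm y c)) d
        ≡⟨ sumSeq-cong-∈ (chainsAbove f y) (λ {c} _ → coeff-chowWeight-⊗ (ρ y ∸ ρ x) (chainTerm y c)) d ⟩
      sumSeq (chainsAbove f y) (λ c → weightTimes (ρ y ∸ ρ x) (coeff (chainTerm y c))) d
        ≡⟨ sumSeq-≗ (weightTimes-linear (ρ y ∸ ρ x)) (chainsAbove f y) _ d ⟨
      weightTimes (ρ y ∸ ρ x) (chainSum f y) d ∎
      where open ≡-Reasoning

  chainSum-top : ∀ f → chainSum f top ≗ ones 1
  chainSum-top zero    d = trans (+-identityʳ _) (coeff-one d)
  chainSum-top (suc f) d = trans (chainSum-suc f top d)
    (trans (cong (ones 1 d +_) (sum-map-zero (allFin m) (λ {y} _ → if-no (top ≺? y) top-maximal)))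
           (+-identityʳ _))

  coeff-chowPoly-0 : rank ≡ 0 → coeff chowPoly 0 ≡ 1
  coeff-chowPoly-0 rank≡0 =
    trans (coeff-chowPoly 0) (trans (cong (λ x → chainSum m x 0) (rank≡0⇒bot≡top rank≡0)) (chainSum-top m 0))

  hVector-of-rank : ∀ {r} → rank ≡ r → hVector ≡ map (coeff chowPoly) (upTo (suc (r ∸ 1)))
  hVector-of-rank rank≡ =
    cong (map (coeff chowPoly) ∘ upTo) (trans (cong (λ r → r ∸ 1 + 1) rank≡) (+-comm _ 1))

-- The order ideal

module ChowIdeal {m : ℕ} (P : WeaklyRankedBoundedPoset m) where
  open WeaklyRankedBoundedPoset P
  open Chow P
  open Chains P
  open IsPartialOrder isPartialOrder using (antisym) renaming (refl to ≼-refl)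

  Between : Fin m → Fin m → Set
  Between x y = x ≺ y × y ≢ top

  between? : ∀ x → Decidable (Between x)
  between? x y = (x ≺? y) ×-dec ¬? (y ≟ᶠ top)

  zeroV : Monomial m
  zeroV = Vec.replicate m 0

  maxExponent : Fin m → Fin m → Monomial m → ℕ
  maxExponent x y v = (ρ₂ x y ∸ 1) ⊓ (ρ₂ y top ∸ (degree v + degree v))

  extensions : Fin m → Fin m → Monomial m → List (Monomial m)
  extensions x y v = applyUpTo (λ a → v [ y ]≔ suc a) (maxExponent x y v)

  -- The variables are the elements of P.  For x ≺ top and enough fuel f, the band sum of ideal f x
  -- is the Chow polynomial of [x, 1̂] (chainSum-bandSum).
  mutual
    ideal : ℕ → Fin m → List (Monomial m)
    ideal zero    x = zeroV ∷ []
    ideal (suc f) x = zeroV ∷ extensionsAbove f x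

    extensionsAbove : ℕ → Fin m → List (Monomial m)
    extensionsAbove f x = concatMap (block f x) (filter (between? x) (allFin m))

    block : ℕ → Fin m → Fin m → List (Monomial m)
    block f x y = concatMap (extensions x y) (ideal f y)

  record Extension (f : ℕ) (x : Fin m) (w : Monomial m) : Set where
    constructor extension
    field
      {y}     : Fin m
      {v}     : Monomial m
      {a}     : ℕ
      between : Between x y
      v∈      : v ∈ ideal f y
      a<max   : a < maxExponent x y v
      w≡      : w ≡ v [ y ]≔ suc a

  ∈-extensionsAbove⁻ : ∀ {f x w} → w ∈ extensionsAbove f x → Extension f x w
  ∈-extensionsAbove⁻ {f} {x} w∈ with find (∈-concatMap⁻ (block f x) {xs = filter (between? x) (allFin m)} w∈)
  ... | y , y∈ , w∈y with find (∈-concatMap⁻ (extensions x y) w∈y)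
  ... | v , v∈ , w∈v with ∈-applyUpTo⁻ (λ a → v [ y ]≔ suc a) w∈v
  ... | a , a<max , w≡ = extension (proj₂ (∈-filter⁻ (between? x) {xs = allFin m} y∈)) v∈ a<max w≡

  ∈-ideal⁻ : ∀ {f x w} → w ∈ ideal (suc f) x → w ≡ zeroV ⊎ Extension f x w
  ∈-ideal⁻ (here w≡0) = inj₁ w≡0
  ∈-ideal⁻ (there w∈) = inj₂ (∈-extensionsAbove⁻ w∈)

  ∈-ideal⁺ : ∀ f {x w} → Extension f x w → w ∈ ideal (suc f) x
  ∈-ideal⁺ f {x} (extension {y} {v} btw v∈ a<max refl) =
    there (∈-concatMap⁺ (block f x) (lose (∈-filter⁺ (between? x) (∈-allFin y) btw)
            (∈-concatMap⁺ (extensions x y) (lose v∈ (∈-applyUpTo⁺ (λ a → v [ y ]≔ suc a) a<max)))))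

  ideal-support : ∀ f x {w z} → w ∈ ideal f x → ¬ x ≺ z → lookup w z ≡ 0
  ideal-support zero    x {z = z} (here refl) _ = lookup-replicate z 0
  ideal-support (suc f) x {w} {z} w∈ x⊀z with ∈-ideal⁻ {f} w∈
  ... | inj₁ refl = lookup-replicate z 0
  ... | inj₂ (extension {y} {v} {a} (x≺y , _) v∈ _ refl) =
    trans (lookup∘update′ z≢y v (suc a)) (ideal-support f y v∈ (x⊀z ∘ ≺-trans x≺y))
    where
    z≢y : z ≢ y
    z≢y refl = x⊀z x≺y

  ideal-lookup-self : ∀ {f y v} → v ∈ ideal f y → lookup v y ≡ 0
  ideal-lookup-self {f} {y} v∈ = ideal-support f y v∈ (≺-irrefl {y})

  degree-extension : ∀ {f y v} a → v ∈ ideal f y → degree (v [ y ]≔ suc a) ≡ degree v + suc a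
  degree-extension {y = y} {v} a v∈ = degree-[]≔ v y (suc a) (ideal-lookup-self {y = y} v∈)

  ideal-degree-bound : ∀ f {x w} → x ≺ top → w ∈ ideal f x → degree w + degree w < ρ₂ x top
  ideal-degree-bound zero x≺top (here refl) =
    subst (λ d → d + d < _) (sym (degree-replicate-0 m)) (ρ₂-positive x≺top)
  ideal-degree-bound (suc f) {x} {w} x≺top w∈ with ∈-ideal⁻ {f} w∈
  ... | inj₁ refl = subst (λ d → d + d < _) (sym (degree-replicate-0 m)) (ρ₂-positive x≺top)
  ... | inj₂ (extension {y} {v} {a} (x≺y , _) v∈ a<max refl) = begin-strict
    degree w + degree w                      ≡⟨ cong (λ d → d + d) (degree-extension {y = y} {v} a v∈) ⟩
    (degree v + suc a) + (degree v + suc a)  ≡⟨ regroup (degree v) a ⟩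
    ((degree v + degree v) + suc a) + suc a  ≤⟨ +-mono-≤ fits-above-y a<K ⟩
    ρ₂ y top + (ρ₂ x y ∸ 1)                  <⟨ n<1+n _ ⟩
    suc (ρ₂ y top + (ρ₂ x y ∸ 1))            ≡⟨ cong suc (+-comm (ρ₂ y top) _) ⟩
    suc (ρ₂ x y ∸ 1) + ρ₂ y top              ≡⟨ ρ₂-split x≺y ⟨
    ρ₂ x top                                 ∎
    where
    open ≤-Reasoning
    regroup : ∀ d a → (d + suc a) + (d + suc a) ≡ ((d + d) + suc a) + suc a
    regroup = solve-∀
    a<K : a < ρ₂ x y ∸ 1
    a<K = <-≤-trans a<max (m⊓n≤m _ _)
    a<rest : a < ρ₂ y top ∸ (degree v + degree v)
    a<rest = <-≤-trans a<max (m⊓n≤n _ _)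
    fits-above-y : (degree v + degree v) + suc a ≤ ρ₂ y top
    fits-above-y = subst (_≤ ρ₂ y top) (+-comm (suc a) _)
      (m≤o∸n⇒m+n≤o (suc a) (<⇒≤ (m∸n≢0⇒n<m λ rest≡0 → n≮0 (subst (a <_) rest≡0 a<rest))) a<rest)

  ideal-fuel-mono : ∀ f {x w} → w ∈ ideal f x → w ∈ ideal (suc f) x
  ideal-fuel-mono zero    (here refl) = here refl
  ideal-fuel-mono (suc f) w∈ with ∈-ideal⁻ {f} w∈
  ... | inj₁ refl                        = here refl
  ... | inj₂ (extension btw v∈ a<max w≡) = ∈-ideal⁺ (suc f) (extension btw (ideal-fuel-mono f v∈) a<max w≡)

  maxExponent-≺-mono : ∀ {x y z} v → x ≺ y → y ≺ z → maxExponent y z v ≤ maxExponent x z v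
  maxExponent-≺-mono {x} {y} {z} v x≺y y≺z = ⊓-monoˡ-≤ _ (∸-monoˡ-≤ 1 ρ₂yz≤ρ₂xz)
    where
    ρ₂yz≤ρ₂xz : ρ₂ y z ≤ ρ₂ x z
    ρ₂yz≤ρ₂xz = subst (ρ₂ y z ≤_) (sym (ρ-add x y z (proj₁ x≺y) (proj₁ y≺z))) (m≤n+m (ρ₂ y z) (ρ₂ x y))

  ideal-≺-mono : ∀ f {x y w} → x ≺ y → w ∈ ideal f y → w ∈ ideal (suc f) x
  ideal-≺-mono zero    x≺y (here refl) = here refl
  ideal-≺-mono (suc f) x≺y w∈ with ∈-ideal⁻ {f} w∈
  ... | inj₁ refl = here refl
  ... | inj₂ (extension {v = v} (y≺z , z≢top) v∈ a<max w≡) =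
    ∈-ideal⁺ (suc f) (extension (≺-trans x≺y y≺z , z≢top) (ideal-fuel-mono f v∈)
                               (<-≤-trans a<max (maxExponent-≺-mono v x≺y y≺z)) w≡)

  -- For u ∣ v · y^a, the part u′ of u away from y divides v.  Either u = u′ ∈ ideal f y ⊆ ideal (suc f) x,
  -- or u = u′ · y^b with b ≤ a, and maxExponent x y v ≤ maxExponent x y u′ as deg u′ ≤ deg v.
  ideal-closed : ∀ f {x u w} → w ∈ ideal f x → u divides w → u ∈ ideal f x
  ideal-closed zero    (here refl) u|w = here (divides-replicate-0 u|w)
  ideal-closed (suc f) {x} {u} w∈ u|w with ∈-ideal⁻ {f} w∈
  ... | inj₁ refl = here (divides-replicate-0 u|w)
  ... | inj₂ (extension {y} {v} {a} btw v∈ a<max refl) =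
    subst (_∈ ideal (suc f) x) u′[y]≔u_y≡u (by-exponent (lookup u y) refl)
    where
    u′ = u [ y ]≔ 0
    u′|v : u′ divides v
    u′|v i with i ≟ᶠ y
    ... | yes refl = subst (_≤ lookup v y) (sym (lookup∘update y u 0)) z≤n
    ... | no  i≢y  = subst₂ _≤_ (sym (lookup∘update′ i≢y u 0)) (lookup∘update′ i≢y v (suc a)) (u|w i)
    u′∈ : u′ ∈ ideal f y
    u′∈ = ideal-closed f v∈ u′|v
    u′[y]≔u_y≡u : u′ [ y ]≔ lookup u y ≡ u
    u′[y]≔u_y≡u = trans ([]≔-idempotent u y) ([]≔-lookup u y)
    by-exponent : ∀ e → lookup u y ≡ e → u′ [ y ]≔ e ∈ ideal (suc f) x
    by-exponent zero    _    =
      subst (_∈ ideal (suc f) x) (sym ([]≔-idempotent u y)) (ideal-≺-mono f (proj₁ btw) u′∈)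
    by-exponent (suc b) u_y≡ = ∈-ideal⁺ f (extension btw u′∈ (≤-trans b<a (≤-trans a<max max-v≤max-u′)) refl)
      where
      b<a : suc b ≤ suc a
      b<a = subst₂ _≤_ u_y≡ (lookup∘update y v (suc a)) (u|w y)
      max-v≤max-u′ : maxExponent x y v ≤ maxExponent x y u′
      max-v≤max-u′ = ⊓-monoʳ-≤ _ (∸-monoʳ-≤ _ (+-mono-≤ (degree-mono u′ v u′|v) (degree-mono u′ v u′|v)))

  OwnedBy : Fin m → Monomial m → Set
  OwnedBy y w = lookup w y ≢ 0 × (∀ {z} → ¬ y ≼ z → lookup w z ≡ 0)

  ownedBy-unique : ∀ {y y′ w} → OwnedBy y w → OwnedBy y′ w → y ≡ y′
  ownedBy-unique {y} {y′} {w} owned owned′ = antisym (below owned owned′) (below owned′ owned)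
    where
    below : ∀ {a b} → OwnedBy a w → OwnedBy b w → a ≼ b
    below {a} {b} (_ , above-a) (w_b≢0 , _) with a ≼? b
    ... | yes a≼b = a≼b
    ... | no  a⋠b = ⊥-elim (w_b≢0 (above-a a⋠b))

  extension-ownedBy : ∀ {f x y v w} → v ∈ ideal f y → w ∈ extensions x y v → OwnedBy y w
  extension-ownedBy {f} {x} {y} {v} v∈ w∈ with ∈-applyUpTo⁻ (λ a → v [ y ]≔ suc a) w∈
  ... | a , _ , refl = (λ w_y≡0 → 0≢1+n (trans (sym w_y≡0) (lookup∘update y v (suc a)))) , vanishes-off-y
    where
    vanishes-off-y : ∀ {z} → ¬ y ≼ z → lookup (v [ y ]≔ suc a) z ≡ 0
    vanishes-off-y y⋠z =
      trans (lookup∘update′ (λ { refl → y⋠z ≼-refl }) v (suc a)) (ideal-support f y v∈ (y⋠z ∘ proj₁))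

  extension-base : ∀ {f x y v w} → v ∈ ideal f y → w ∈ extensions x y v → w [ y ]≔ 0 ≡ v
  extension-base {f} {x} {y} {v} v∈ w∈ with ∈-applyUpTo⁻ (λ a → v [ y ]≔ suc a) w∈
  ... | a , _ , refl =
    trans ([]≔-idempotent v y) (trans (cong (v [ y ]≔_) (sym (ideal-lookup-self {f} v∈))) ([]≔-lookup v y))

  extensions-unique : ∀ x y v → Unique (extensions x y v)
  extensions-unique x y v = applyUpTo⁺₁ (λ a → v [ y ]≔ suc a) (maxExponent x y v)
    (λ i<j _ eq → <⇒≢ i<j (suc-injective (exponent eq)))
    where
    exponent : ∀ {i j} → v [ y ]≔ suc i ≡ v [ y ]≔ suc j → suc i ≡ suc j
    exponent {i} {j} eq = trans (sym (lookup∘update y v (suc i)))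
                                (trans (cong (λ w → lookup w y) eq) (lookup∘update y v (suc j)))

  -- Blocks for different y are disjoint because y is the least variable of v · y^a (OwnedBy);
  -- within a block, v is recovered from v · y^a by setting the exponent of y to 0.
  ideal-unique : ∀ f x → Unique (ideal f x)
  ideal-unique zero    x = All.[] ∷ []
  ideal-unique (suc f) x =
    All.tabulate zeroV∉ ∷
    concatMap-unique (block f x) (filter⁺ (between? x) (allFin⁺ m)) (λ {y} _ → block-unique y) block-key
    where
    zeroV∉ : ∀ {w} → w ∈ extensionsAbove f x → zeroV ≢ w
    zeroV∉ w∈ refl with ∈-extensionsAbove⁻ {f} w∈
    ... | extension {y} {v} {a} _ _ _ eq = 0≢1+n
      (trans (sym (lookup-replicate y 0)) (trans (cong (λ w → lookup w y) eq) (lookup∘update y v (suc a))))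
    block-unique : ∀ y → Unique (block f x y)
    block-unique y = concatMap-unique (extensions x y) (ideal-unique f y) (λ _ → extensions-unique x y _)
      (λ v∈ v′∈ w∈ w∈′ → trans (sym (extension-base {f} v∈ w∈)) (extension-base {f} v′∈ w∈′))
    owner : ∀ {y w} → w ∈ block f x y → OwnedBy y w
    owner {y} w∈ with find (∈-concatMap⁻ (extensions x y) {xs = ideal f y} w∈)
    ... | v , v∈ , w∈v = extension-ownedBy {f} v∈ w∈v
    block-key : ∀ {y y′ w} → _ → _ → w ∈ block f x y → w ∈ block f x y′ → y ≡ y′
    block-key {w = w} _ _ w∈ w∈′ = ownedBy-unique {w = w} (owner w∈) (owner w∈′)

  bandSum-extensions : ∀ f {x y v} → x ≺ y → v ∈ ideal f y →
    bandSum (ρ₂ x top) (extensions x y v) ≗ weightTimes (ρ₂ x y) (band (ρ₂ y top) (degree v))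
  bandSum-extensions f {x} {y} {v} x≺y v∈ d = begin
    sum (map (λ w → band (ρ₂ x top) (degree w) d) (applyUpTo (λ a → v [ y ]≔ suc a) r))
      ≡⟨ cong sum (map-applyUpTo _ _ r) ⟩
    sum (applyUpTo (λ a → band (ρ₂ x top) (degree (v [ y ]≔ suc a)) d) r)
      ≡⟨ cong sum (applyUpTo-cong-< _ _ r (λ {a} _ → extension-term a)) ⟩
    sum (applyUpTo (λ a → band (suc K + ρ₂ y top) (degree v + suc a) d) r)
      ≡⟨ cong sum (map-upTo _ r) ⟨
    sumSeq (upTo r) (λ a → band (suc K + ρ₂ y top) (degree v + suc a)) d
      ≡⟨ weightTimes-band K (ρ₂ y top) (degree v) d ⟨
    weightTimes (suc K) (band (ρ₂ y top) (degree v)) d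
      ≡⟨ cong (λ k → weightTimes k (band (ρ₂ y top) (degree v)) d) (suc-ρ₂-∸1 x≺y) ⟩
    weightTimes (ρ₂ x y) (band (ρ₂ y top) (degree v)) d ∎
    where
    open ≡-Reasoning
    K = ρ₂ x y ∸ 1
    r = maxExponent x y v
    extension-term : ∀ a →
      band (ρ₂ x top) (degree (v [ y ]≔ suc a)) d ≡ band (suc K + ρ₂ y top) (degree v + suc a) d
    extension-term a = cong₂ (λ N j → band N j d) (ρ₂-split x≺y) (degree-extension {f} a v∈)

  chainSum-bandSum : ∀ f {x} → x ≺ top → upSize x ≤ f → chainSum f x ≗ bandSum (ρ₂ x top) (ideal f x)
  chainSum-bandSum zero    x≺top fuel = ⊥-elim (n≮0 (<-≤-trans (upSize-< x≺top) fuel))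
  chainSum-bandSum (suc f) {x} x≺top fuel d = begin
    chainSum (suc f) x d
      ≡⟨ chainSum-suc f x d ⟩
    ones 1 d + sum (map (λ y → if does (x ≺? y) then G y else 0) (allFin m))
      ≡⟨ cong (ones 1 d +_) (sum-map-cong-∈ (allFin m) (λ {y} _ → split-top y)) ⟩
    ones 1 d + sum (map (λ y → atTop y + inside y) (allFin m))
      ≡⟨ cong (ones 1 d +_) (sum-map-+ atTop inside (allFin m)) ⟩
    ones 1 d + (sum (map atTop (allFin m)) + sum (map inside (allFin m)))
      ≡⟨ cong (λ s → ones 1 d + (s + sum (map inside (allFin m))))
              (sum-map-if-≟ _≟ᶠ_ (G top) (allFin⁺ m) (∈-allFin top)) ⟩
    ones 1 d + (G top + sum (map inside (allFin m)))
      ≡⟨ +-assoc (ones 1 d) (G top) _ ⟨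
    ones 1 d + G top + sum (map inside (allFin m))
      ≡⟨ cong₂ _+_ top-term (sym (sum-map-filter (between? x) G (allFin m))) ⟩
    band N (degree zeroV) d + sum (map G (filter (between? x) (allFin m)))
      ≡⟨ cong (band N (degree zeroV) d +_) (sum-map-cong-∈ (filter (between? x) (allFin m)) block-term) ⟩
    band N (degree zeroV) d + sum (map (λ y → bandSum N (block f x y) d) (filter (between? x) (allFin m)))
      ≡⟨ cong (band N (degree zeroV) d +_) (sum-map-concatMap _ _ (filter (between? x) (allFin m))) ⟨
    bandSum N (ideal (suc f) x) d ∎
    where
    open ≡-Reasoning
    N = ρ₂ x top
    G : Fin m → ℕ
    G y = weightTimes (ρ y ∸ ρ x) (chainSum f y) d
    atTop inside : Fin m → ℕ
    atTop y  = if does (y ≟ᶠ top) then G top else 0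
    inside y = if does (between? x y) then G y else 0
    split-top : ∀ y → (if does (x ≺? y) then G y else 0) ≡ atTop y + inside y
    split-top y = by-cases (y ≟ᶠ top) (x ≺? y)
      where
      by-cases : (y≟top : Dec (y ≡ top)) → Dec (x ≺ y) →
        (if does (x ≺? y) then G y else 0) ≡ (if does y≟top then G top else 0) + inside y
      by-cases (yes refl) _ = trans (if-yes (x ≺? top) x≺top)
        (sym (trans (cong (G top +_) (if-no (between? x top) (λ btw → proj₂ btw refl))) (+-identityʳ _)))
      by-cases (no y≢top) (yes x≺y) = trans (if-yes (x ≺? y) x≺y) (sym (if-yes (between? x y) (x≺y , y≢top)))
      by-cases (no y≢top) (no  x⊀y) = trans (if-no (x ≺? y) x⊀y) (sym (if-no (between? x y) (x⊀y ∘ proj₁)))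
    top-term : ones 1 d + G top ≡ band N (degree zeroV) d
    top-term = begin
      ones 1 d + weightTimes (ρ top ∸ ρ x) (chainSum f top) d
        ≡⟨ cong (λ k → ones 1 d + weightTimes k (chainSum f top) d) (ρ-∸ (proj₁ x≺top)) ⟩
      ones 1 d + weightTimes N (chainSum f top) d
        ≡⟨ cong (ones 1 d +_) (weightTimes-linear N .cong-≗ (chainSum-top f) d) ⟩
      ones 1 d + weightTimes N (ones 1) d
        ≡⟨ ones-weightTimes-one (ρ₂-positive x≺top) d ⟨
      band N 0 d
        ≡⟨ cong (λ j → band N j d) (degree-replicate-0 m) ⟨
      band N (degree zeroV) d ∎
    block-term : ∀ {y} → y ∈ filter (between? x) (allFin m) → G y ≡ bandSum N (block f x y) d
    block-term {y} y∈ with ∈-filter⁻ (between? x) {xs = allFin m} y∈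
    ... | _ , (x≺y , y≢top) = begin
      weightTimes (ρ y ∸ ρ x) (chainSum f y) d
        ≡⟨ cong (λ k → weightTimes k (chainSum f y) d) (ρ-∸ (proj₁ x≺y)) ⟩
      weightTimes (ρ₂ x y) (chainSum f y) d
        ≡⟨ weightTimes-linear (ρ₂ x y) .cong-≗ (chainSum-bandSum f (top-greatest y , y≢top) fuel′) d ⟩
      weightTimes (ρ₂ x y) (bandSum (ρ₂ y top) (ideal f y)) d
        ≡⟨ sumSeq-≗ (weightTimes-linear (ρ₂ x y)) (ideal f y) _ d ⟩
      sumSeq (ideal f y) (λ v → weightTimes (ρ₂ x y) (band (ρ₂ y top) (degree v))) d
        ≡⟨ sumSeq-cong-∈ (ideal f y) (bandSum-extensions f x≺y) d ⟨
      sum (map (λ v → bandSum N (extensions x y v) d) (ideal f y))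
        ≡⟨ sum-map-concatMap _ (extensions x y) (ideal f y) ⟨
      bandSum N (block f x y) d ∎
      where
      fuel′ : upSize y ≤ f
      fuel′ = ≤-pred (<-≤-trans (upSize-< x≺y) fuel)

  ideal-count-0 : ∀ f x → sum (map (λ w → δ (degree w) 0) (ideal f x)) ≡ 1
  ideal-count-0 zero    x = cong (λ d → δ d 0 + 0) (degree-replicate-0 m)
  ideal-count-0 (suc f) x =
    cong₂ _+_ (cong (λ d → δ d 0) (degree-replicate-0 m)) (sum-map-zero (extensionsAbove f x) positive)
    where
    positive : ∀ {w} → w ∈ extensionsAbove f x → δ (degree w) 0 ≡ 0
    positive w∈ with ∈-extensionsAbove⁻ {f} w∈
    ... | extension {a = a} _ v∈ _ refl =
      δ-≢ (λ deg≡0 → 0≢1+n (trans (sym deg≡0) (trans (degree-extension {f} a v∈) (+-suc _ a))))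

  chowIdeal : MonomialOrderIdeal m
  chowIdeal = record
    { monomials = ideal m bot
    ; distinct  = ideal-unique m bot
    ; closed    = λ w∈ u|w → ideal-closed m w∈ u|w
    }

  chowIdeal-count-0 : MonomialOrderIdeal.numOfDegree chowIdeal 0 ≡ 1
  chowIdeal-count-0 = trans (length-filter-≟ degree 0 (ideal m bot)) (ideal-count-0 m bot)

  chowIdeal-degree-bound : ∀ {n} → rank ≡ suc n → ∀ {v} → v ∈ ideal m bot → degree v + degree v ≤ n
  chowIdeal-degree-bound rank≡ v∈ =
    ≤-pred (subst (_ <_) rank≡ (ideal-degree-bound m (rank≡suc⇒bot≺top rank≡) v∈))

  coeff-chowPoly-bandSum : ∀ {n} → rank ≡ suc n → coeff chowPoly ≗ bandSum (suc n) (ideal m bot)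
  coeff-chowPoly-bandSum rank≡ d = begin
    coeff chowPoly d               ≡⟨ coeff-chowPoly d ⟩
    chainSum m bot d               ≡⟨ chainSum-bandSum m (rank≡suc⇒bot≺top rank≡) (upSize≤m bot) d ⟩
    bandSum rank (ideal m bot) d   ≡⟨ cong (λ N → bandSum N (ideal m bot) d) rank≡ ⟩
    bandSum _ (ideal m bot) d      ∎
    where open ≡-Reasoning

isSISequence-[1] : IsSISequence (1 ∷ [])
isSISequence-[1] = refl , z<s , refl , (1 ∷ [] , refl , (0 , point , counts))
  where
  point : MonomialOrderIdeal 0
  point = record { monomials = [] ∷ [] ; distinct = All.[] ∷ [] ; closed = λ { {[]} _ _ → here refl } }
  counts : IsHVectorOf (1 ∷ []) point
  counts zero    = refl
  counts (suc d) = refl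

theorem1p1 : (m : ℕ) (P : WeaklyRankedBoundedPoset m) → IsSISequence (Chow.hVector P)
theorem1p1 m P = by-rank rank refl
  where
  open WeaklyRankedBoundedPoset P
  open Chow P
  open Chains P
  open ChowIdeal P
  by-rank : ∀ r → rank ≡ r → IsSISequence hVector
  by-rank zero    rank≡0 = subst IsSISequence (sym (hVector-of-rank rank≡0))
    (subst (λ h₀ → IsSISequence (h₀ ∷ [])) (sym (coeff-chowPoly-0 rank≡0)) isSISequence-[1])
  by-rank (suc n) rank≡  = subst IsSISequence (sym (hVector-of-rank rank≡))
    (subst IsSISequence (map-cong (sym ∘ coeff-chowPoly-bandSum rank≡) (upTo (suc n)))
      (isSISequence-bandSum n chowIdeal chowIdeal-count-0 (chowIdeal-degree-bound rank≡)))
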